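{- Let $A_n=|P(T,n\times n)|$ be the number of distinct $n\times n$ patterns occurring in the squiral tiling. Then for all integers $n\geq 2$, \[ \begin{aligned} A_{3n-2}&=9A_n,\\ A_{9n-7}&=5A_{3n+1}-16A_{3n}+20A_{3n-1},\\ A_{9n-4}&=-A_{3n+1}+5A_{3n}+5A_{3n-1},\\ A_{9n-1}&=2A_{3n+1}+8A_{3n}-A_{3n-1},\\ A_{3n}&=A_{3n-1}+3A_{n+1}-3A_n, \end{aligned} \] and the initial values are $A_1=2$, $A_2=14$, $A_3=70$, $A_4=126$, $A_5=270$, $A_6=438$, $A_7=630$, $A_8=790$.
   Context: Work over the alphabet $\{0,1\}$ and regard patterns as binary matrices. The block substitution $\mu$ maps $0$ to the $3\times3$ matrix with rows $(1,0,1),(0,0,0),(1,0,1)$ and $1$ to the $3\times3$ matrix with rows $(0,1,0),(1,1,1),(0,1,0)$; it acts on a binary matrix by replacing each entry by its $3\times3$ image block. Let $T_k=\mu^k(0)$; the squiral tiling $T$ is their limit. $P(T,m\times n)=\bigcup_{k\ge0}P(T_k,m\times n)$, where $P(S,m\times n)$ is the set of all $m\times n$ contiguous submatrices of $S$. -}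

module Defs where

open import Data.Bool using (Bool; true; false)
open import Data.Nat using (ℕ; zero; suc; _+_; _*_; _^_; _≤_; _/_)
open import Data.Nat.DivMod using (_mod_)
open import Data.Fin using (Fin; toℕ)
open import Data.Vec using (Vec; []; _∷_; lookup; tabulate)
open import Data.List using (List; length)
open import Data.List.Relation.Unary.All using (All)
open import Data.List.Relation.Unary.Unique.Propositional using (Unique)
open import Data.List.Membership.Propositional using (_∈_)
open import Data.Product using (Σ; ∃; _×_)
open import Relation.Binary.PropositionalEquality using (_≡_)

-- Binary alphabet {0,1} encoded as Bool: false = 0, true = 1.
-- An m×n binary matrix is a vector of m rows, each a vector of n entries.
Matrix : ℕ → ℕ → Set
Matrix m n = Vec (Vec Bool n) m

μ0 : Matrix 3 3
μ0 = (true ∷ false ∷ true ∷ [])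
   ∷ (false ∷ false ∷ false ∷ [])
   ∷ (true ∷ false ∷ true ∷ []) ∷ []

μ1 : Matrix 3 3
μ1 = (false ∷ true ∷ false ∷ [])
   ∷ (true ∷ true ∷ true ∷ [])
   ∷ (false ∷ true ∷ false ∷ []) ∷ []

μblock : Bool → Matrix 3 3
μblock false = μ0
μblock true  = μ1

-- T k i j = entry in row i, column j (0-based) of T_k = μ^k(0),
-- a 3^k × 3^k matrix, using T_{k+1} = μ(T_k): the entry (i,j) of μ(S) is
-- entry (i mod 3, j mod 3) of the block μ(S (i/3) (j/3)).
-- (Only meaningful for i, j < 3^k.)
T : ℕ → ℕ → ℕ → Bool
T zero    i j = false
T (suc k) i j = lookup (lookup (μblock (T k (i / 3) (j / 3))) (i mod 3)) (j mod 3)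

window : (k a b m n : ℕ) → Matrix m n
window k a b m n = tabulate (λ i → tabulate (λ j → T k (a + toℕ i) (b + toℕ j)))

InPatterns : (k : ℕ) {m n : ℕ} → Matrix m n → Set
InPatterns k {m} {n} M =
  ∃ λ a → ∃ λ b → (a + m ≤ 3 ^ k) × (b + n ≤ 3 ^ k) × (M ≡ window k a b m n)

Occurs : {m n : ℕ} → Matrix m n → Set
Occurs M = ∃ λ k → InPatterns k M

HasCount : ℕ → ℕ → Set
HasCount n c =
  Σ (List (Matrix n n)) λ L →
    (length L ≡ c) × Unique L × All Occurs L × (∀ (M : Matrix n n) → Occurs M → M ∈ L)

{-# OPTIONS --safe #-}
module Submission where

-- Let m, n ≥ 4. Every m × n pattern of T_{k+1} = μ(T_k) is the window at some offset
-- (r, s) ∈ {0,1,2}² of the μ-image of a ⌈(r+m)/3⌉ × ⌈(s+n)/3⌉ pattern of T_k, and both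
-- the offset and the preimage are unique: the offset can be read off the top-left 4 × 4
-- corner (a finite check), and the μ-image is injective because μ(1) is the complement
-- of μ(0). So the number R(m, n) of m × n patterns satisfies
--   R(m, n) = Σ_{r,s} R(⌈(r+m)/3⌉, ⌈(s+n)/3⌉),
-- while the near-square sizes below 4 × 4 are settled by a verified table of occurrences.
-- For a size t + 3p with 1 ≤ t ≤ 4 the three offsets give p + 1 (4 − t times) and p + 2
-- (t − 1 times). Hence every size in the lemma has a weight vector over (n, n+1), e.g.
-- 3n−1 ↦ (2,1) and 9n−7 ↦ 2·(3,0) + (2,1) = (8,1), and A at that size is the quadratic
-- form of this vector in R(n,n), R(n,n+1), R(n+1,n), R(n+1,n+1). The recurrences are
-- linear identities between these quadratic forms.

open import Defs
open import Data.Bool using (Bool; true; false; not)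
import Data.Bool.Properties as Bool
open import Data.Empty using (⊥-elim)
open import Data.Fin using (Fin; toℕ)
open import Data.Fin.Properties using (toℕ<n; toℕ-fromℕ<; toℕ-injective; all?) renaming (_≟_ to _≟ᶠ_)
open import Data.Integer using (ℤ; +_; _-_) renaming (_+_ to _+ℤ_; _*_ to _*ℤ_)
open import Data.Integer.Properties using (pos-+; pos-*)
import Data.Integer.Tactic.RingSolver as ℤ-Ring
open import Data.List using (List; []; _∷_; _++_; map; concat; concatMap; length; allFin; upTo; filter; cartesianProduct; cartesianProductWith)
open import Data.List.Membership.Propositional using (_∈_)
open import Data.List.Membership.Propositional.Properties
  using (∈-map⁺; ∈-map⁻; ∈-concat⁺′; ∈-cartesianProductWith⁺; ∈-cartesianProduct⁺; ∈-allFin; ∈-upTo⁺; ∈-filter⁺)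
open import Data.List.Properties using (map-cong; map-∘; map-++; length-map; length-++)
open import Data.List.Relation.Binary.Disjoint.Propositional using (Disjoint)
open import Data.List.Relation.Unary.All as All using (All)
import Data.List.Relation.Unary.All.Properties as All
open import Data.List.Relation.Unary.Any as Any using (here; there)
import Data.List.Relation.Unary.AllPairs as AllPairs
import Data.List.Relation.Unary.AllPairs.Properties as AllPairs
open import Data.List.Relation.Unary.Unique.Propositional using (Unique)
import Data.List.Relation.Unary.Unique.Propositional.Properties as Unique
open import Data.Nat using (ℕ; zero; suc; _+_; _*_; _∸_; _^_; _/_; _%_; _≤_; _<_; _≤?_; _<?_; z≤n; s≤s; z<s)
open import Data.Nat.DivMod using (_mod_; m≡m%n+[m/n]*n; m%n<n; [m+kn]%n≡m%n; +-distrib-/-∣ˡ; m*n/n≡m; m/n*n≤m; /-monoˡ-≤; m<n*o⇒m/o<n; m<n⇒m/n≡0)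
open import Data.Nat.Divisibility using (divides)
open import Data.Nat.ListAction using (sum)
open import Data.Nat.ListAction.Properties using (sum-++)
open import Data.Nat.Properties
import Data.Nat.Tactic.RingSolver as ℕ-Ring
open import Data.Product using (∃; _×_; _,_; proj₁; proj₂)
open import Data.Product.Properties using () renaming (≡-dec to ×-≡-dec)
open import Data.Vec using (Vec; lookup; tabulate; replicate)
open import Data.Vec.Properties using (tabulate-cong; lookup-map) renaming (≡-dec to Vec-≡-dec)
import Data.Vec as Vec
open import Function using (_∘_; _∘′_)
open import Relation.Binary.Definitions using (DecidableEquality)
open import Relation.Nullary using (¬_; Dec; yes; no; ¬?)
open import Relation.Nullary.Decidable using (True; toWitness; _×-dec_; _→-dec_)
open import Relation.Unary using (Decidable)
open import Relation.Binary.PropositionalEquality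

-- Out-of-range indices read the default d, so entries can be addressed without bound proofs.
at : {X : Set} {n : ℕ} → X → Vec X n → ℕ → X
at d Vec.[]       _       = d
at d (x Vec.∷ xs) zero    = x
at d (x Vec.∷ xs) (suc i) = at d xs i

at-tabulate : {X : Set} {n : ℕ} (d : X) (g : ℕ → X) {i : ℕ} → i < n → at d (tabulate {n = n} (g ∘ toℕ)) i ≡ g i
at-tabulate {n = suc n} d g {zero}  _         = refl
at-tabulate {n = suc n} d g {suc i} (s≤s i<n) = at-tabulate d (g ∘ suc) i<n

at-ext : {X : Set} {n : ℕ} (d : X) (u v : Vec X n) → (∀ {i} → i < n → at d u i ≡ at d v i) → u ≡ v
at-ext d Vec.[]      Vec.[]      _  = refl
at-ext d (x Vec.∷ u) (y Vec.∷ v) eq = cong₂ Vec._∷_ (eq z<s) (at-ext d u v (eq ∘ s≤s))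

entry : {m n : ℕ} → Matrix m n → ℕ → ℕ → Bool
entry M i j = at false (at (replicate _ false) M i) j

matrix : (m n : ℕ) → (ℕ → ℕ → Bool) → Matrix m n
matrix m n g = tabulate λ i → tabulate λ j → g (toℕ i) (toℕ j)

entry-matrix : ∀ {m n} g {i j} → i < m → j < n → entry (matrix m n g) i j ≡ g i j
entry-matrix g i<m j<n =
  trans (cong (λ row → at false row _) (at-tabulate _ (λ i → tabulate λ j → g i (toℕ j)) i<m))
        (at-tabulate false (g _) j<n)

matrix-ext : ∀ {m n} (M N : Matrix m n) → (∀ {i j} → i < m → j < n → entry M i j ≡ entry N i j) → M ≡ N
matrix-ext M N eq = at-ext _ M N λ i<m → at-ext false _ _ (eq i<m)

matrix-cong : ∀ {m n} g h → (∀ {i j} → i < m → j < n → g i j ≡ h i j) → matrix m n g ≡ matrix m n h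
matrix-cong _ _ eq = tabulate-cong λ i → tabulate-cong λ j → eq (toℕ<n i) (toℕ<n j)

crop : ∀ {m n} (m′ n′ : ℕ) → Matrix m n → Matrix m′ n′
crop m′ n′ M = matrix m′ n′ (entry M)

⌈_/3⌉ : ℕ → ℕ
⌈ x /3⌉ = (x + 2) / 3

[a*3+x]/3≡a+x/3 : ∀ a x → (a * 3 + x) / 3 ≡ a + x / 3
[a*3+x]/3≡a+x/3 a x = trans (+-distrib-/-∣ˡ x (divides a refl)) (cong (_+ x / 3) (m*n/n≡m a 3))

⌈x+a*3/3⌉≡⌈x/3⌉+a : ∀ x a → ⌈ x + a * 3 /3⌉ ≡ ⌈ x /3⌉ + a
⌈x+a*3/3⌉≡⌈x/3⌉+a x a = begin
  (x + a * 3 + 2) / 3    ≡⟨ cong (_/ 3) (rearrange x a) ⟩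
  (a * 3 + (x + 2)) / 3  ≡⟨ [a*3+x]/3≡a+x/3 a (x + 2) ⟩
  a + ⌈ x /3⌉            ≡⟨ +-comm a _ ⟩
  ⌈ x /3⌉ + a            ∎
  where
  open ≡-Reasoning
  rearrange : ∀ x a → x + a * 3 + 2 ≡ a * 3 + (x + 2)
  rearrange = ℕ-Ring.solve-∀

⌈/3⌉-mono : ∀ {x y} → x ≤ y → ⌈ x /3⌉ ≤ ⌈ y /3⌉
⌈/3⌉-mono x≤y = /-monoˡ-≤ 3 (+-monoˡ-≤ 2 x≤y)

x<y⇒x/3<⌈y/3⌉ : ∀ {x y} → x < y → x / 3 < ⌈ y /3⌉
x<y⇒x/3<⌈y/3⌉ {x} {y} x<y = begin
  suc (x / 3)   ≡⟨ [a*3+x]/3≡a+x/3 1 x ⟨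
  (3 + x) / 3   ≤⟨ /-monoˡ-≤ 3 (≤-trans (≤-reflexive (+-comm 2 (suc x))) (+-monoˡ-≤ 2 x<y)) ⟩
  ⌈ y /3⌉       ∎
  where open ≤-Reasoning

x≤⌈x/3⌉*3 : ∀ x → x ≤ ⌈ x /3⌉ * 3
x≤⌈x/3⌉*3 x = +-cancelʳ-≤ 2 x _ (begin
  x + 2                       ≡⟨ m≡m%n+[m/n]*n (x + 2) 3 ⟩
  (x + 2) % 3 + ⌈ x /3⌉ * 3   ≤⟨ +-monoˡ-≤ _ (≤-pred (m%n<n (x + 2) 3)) ⟩
  2 + ⌈ x /3⌉ * 3             ≡⟨ +-comm 2 _ ⟩
  ⌈ x /3⌉ * 3 + 2             ∎)
  where open ≤-Reasoning

expansion-bound : ∀ r a m K → a + ⌈ r + m /3⌉ ≤ K → a * 3 + r + m ≤ 3 * K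
expansion-bound r a m K h = begin
  a * 3 + r + m             ≡⟨ +-assoc (a * 3) r m ⟩
  a * 3 + (r + m)           ≤⟨ +-monoʳ-≤ (a * 3) (x≤⌈x/3⌉*3 (r + m)) ⟩
  a * 3 + ⌈ r + m /3⌉ * 3   ≡⟨ *-distribʳ-+ 3 a _ ⟨
  (a + ⌈ r + m /3⌉) * 3     ≤⟨ *-monoˡ-≤ 3 h ⟩
  K * 3                     ≡⟨ *-comm K 3 ⟩
  3 * K                     ∎
  where open ≤-Reasoning

preimage-bound : ∀ r a m K → a * 3 + r + m ≤ 3 * K → a + ⌈ r + m /3⌉ ≤ K
preimage-bound r a m K h = begin
  a + ⌈ r + m /3⌉             ≡⟨ [a*3+x]/3≡a+x/3 a (r + m + 2) ⟨
  (a * 3 + (r + m + 2)) / 3   ≤⟨ /-monoˡ-≤ 3 (≤-trans (≤-reflexive (sym (+-assoc (a * 3) (r + m) 2)))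
                                   (+-monoˡ-≤ 2 (≤-trans (≤-reflexive (sym (+-assoc (a * 3) r m))) h))) ⟩
  (3 * K + 2) / 3             ≡⟨ cong (λ x → (x + 2) / 3) (*-comm 3 K) ⟩
  ⌈ 0 + K * 3 /3⌉             ≡⟨ ⌈x+a*3/3⌉≡⌈x/3⌉+a 0 K ⟩
  K                           ∎
  where open ≤-Reasoning

toℕ≤2 : (r : Fin 3) → toℕ r ≤ 2
toℕ≤2 r = ≤-pred (toℕ<n r)

preimage-positive : ∀ r {m} → 1 ≤ m → 1 ≤ ⌈ r + m /3⌉
preimage-positive r {m} 1≤m = ⌈/3⌉-mono (≤-trans 1≤m (m≤n+m m r))

preimage-near : ∀ {r m} s {n} → r ≤ 2 → m ≤ suc n → ⌈ r + m /3⌉ ≤ suc ⌈ s + n /3⌉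
preimage-near {r} {m} s {n} r≤2 m≤1+n = begin
  ⌈ r + m /3⌉          ≤⟨ ⌈/3⌉-mono (+-mono-≤ r≤2 m≤1+n) ⟩
  ⌈ 3 + n /3⌉          ≤⟨ ⌈/3⌉-mono (+-monoʳ-≤ 3 (m≤n+m n s)) ⟩
  ⌈ 3 + (s + n) /3⌉    ≡⟨ [a*3+x]/3≡a+x/3 1 (s + n + 2) ⟩
  suc ⌈ s + n /3⌉      ∎
  where open ≤-Reasoning

preimage-smaller : ∀ {r m} → r ≤ 2 → 4 ≤ m → ⌈ r + m /3⌉ < m
preimage-smaller {r} {m} r≤2 4≤m = ≤-<-trans (⌈/3⌉-mono (+-monoˡ-≤ m r≤2)) (m<n*o⇒m/o<n (begin-strict
  2 + m + 2   ≡⟨ +-comm (2 + m) 2 ⟩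
  4 + m       <⟨ +-monoˡ-< m (s≤s (s≤s (s≤s (s≤s (s≤s z≤n))))) ⟩
  8 + m       ≤⟨ +-monoˡ-≤ m (*-monoˡ-≤ 2 4≤m) ⟩
  m * 2 + m   ≡⟨ +-comm (m * 2) m ⟩
  m + m * 2   ≡⟨ *-suc m 2 ⟨
  m * 3       ∎))
  where open ≤-Reasoning

preimage-small : ∀ {r m} → r ≤ 2 → m < 4 → ⌈ r + m /3⌉ < 4
preimage-small r≤2 m<4 = ≤-<-trans (⌈/3⌉-mono (+-mono-≤ r≤2 (≤-pred m<4))) (s≤s (s≤s (s≤s z≤n)))

[r+i]/3-onto : ∀ r m {i′} → r ≤ 2 → 1 ≤ m → i′ < ⌈ r + m /3⌉ → ∃ λ i → i < m × (r + i) / 3 ≡ i′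
[r+i]/3-onto r m {zero}  r≤2 1≤m _ = 0 , 1≤m , m<n⇒m/n≡0 (s≤s (≤-trans (≤-reflexive (+-identityʳ r)) r≤2))
[r+i]/3-onto r m {suc t} r≤2 _ i′<c = x ∸ r , i<m , (begin-equality
  (r + (x ∸ r)) / 3   ≡⟨ cong (_/ 3) (m+[n∸m]≡n r≤x) ⟩
  x / 3               ≡⟨ m*n/n≡m (suc t) 3 ⟩
  suc t               ∎)
  where
  open ≤-Reasoning
  x : ℕ
  x = suc t * 3
  r≤x : r ≤ x
  r≤x = ≤-trans r≤2 (m≤m+n 2 (suc (t * 3)))
  i<m : suc (x ∸ r) ≤ m
  i<m = +-cancelˡ-≤ r _ _ (+-cancelʳ-≤ 2 _ _ (begin
    r + suc (x ∸ r) + 2     ≡⟨ cong (_+ 2) (+-suc r (x ∸ r)) ⟩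
    suc (r + (x ∸ r)) + 2   ≡⟨ cong (λ y → suc y + 2) (m+[n∸m]≡n r≤x) ⟩
    suc x + 2               ≡⟨ +-comm (suc x) 2 ⟩
    3 + x                   ≤⟨ *-monoˡ-≤ 3 i′<c ⟩
    ⌈ r + m /3⌉ * 3         ≤⟨ m/n*n≤m (r + m + 2) 3 ⟩
    r + m + 2               ∎))

-- The substitution on windows

μ-entry : Bool → ℕ → ℕ → Bool
μ-entry x i j = lookup (lookup (μblock x) (i mod 3)) (j mod 3)

mod3-periodic : ∀ a x → (a * 3 + x) mod 3 ≡ x mod 3
mod3-periodic a x = toℕ-injective (begin
  toℕ ((a * 3 + x) mod 3)   ≡⟨ toℕ-fromℕ< _ ⟩
  (a * 3 + x) % 3           ≡⟨ cong (_% 3) (+-comm (a * 3) x) ⟩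
  (x + a * 3) % 3           ≡⟨ [m+kn]%n≡m%n x a 3 ⟩
  x % 3                     ≡⟨ toℕ-fromℕ< _ ⟨
  toℕ (x mod 3)             ∎)
  where open ≡-Reasoning

mod3-decomposition : ∀ a → a ≡ a / 3 * 3 + toℕ (a mod 3)
mod3-decomposition a = begin
  a                           ≡⟨ m≡m%n+[m/n]*n a 3 ⟩
  a % 3 + a / 3 * 3           ≡⟨ +-comm (a % 3) _ ⟩
  a / 3 * 3 + a % 3           ≡⟨ cong (λ x → a / 3 * 3 + x) (toℕ-fromℕ< _) ⟨
  a / 3 * 3 + toℕ (a mod 3)   ∎
  where open ≡-Reasoning

μ-entry-periodic : ∀ z a b x y → μ-entry z (a * 3 + x) (b * 3 + y) ≡ μ-entry z x y
μ-entry-periodic z a b x y = cong₂ (λ p q → lookup (lookup (μblock z) p) q) (mod3-periodic a x) (mod3-periodic b y)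

T-expansion : ∀ k a b x y → T (suc k) (a * 3 + x) (b * 3 + y) ≡ μ-entry (T k (a + x / 3) (b + y / 3)) x y
T-expansion k a b x y = begin
  μ-entry (T k ((a * 3 + x) / 3) ((b * 3 + y) / 3)) (a * 3 + x) (b * 3 + y)
    ≡⟨ μ-entry-periodic (T k ((a * 3 + x) / 3) ((b * 3 + y) / 3)) a b x y ⟩
  μ-entry (T k ((a * 3 + x) / 3) ((b * 3 + y) / 3)) x y
    ≡⟨ cong₂ (λ u v → μ-entry (T k u v) x y) ([a*3+x]/3≡a+x/3 a x) ([a*3+x]/3≡a+x/3 b y) ⟩
  μ-entry (T k (a + x / 3) (b + y / 3)) x y
    ∎
  where open ≡-Reasoning

μ-entry-complement : ∀ i j → μ-entry true i j ≡ not (μ-entry false i j)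
μ-entry-complement i j = begin
  μ-entry true i j
    ≡⟨⟩
  lookup (lookup (Vec.map (Vec.map not) μ0) (i mod 3)) (j mod 3)
    ≡⟨ cong (λ row → lookup row (j mod 3)) (lookup-map (i mod 3) (Vec.map not) μ0) ⟩
  lookup (Vec.map not (lookup μ0 (i mod 3))) (j mod 3)
    ≡⟨ lookup-map (j mod 3) not (lookup μ0 (i mod 3)) ⟩
  not (μ-entry false i j)
    ∎
  where open ≡-Reasoning

μ-entry-injective : ∀ {x y} i j → μ-entry x i j ≡ μ-entry y i j → x ≡ y
μ-entry-injective {false} {false} _ _ _ = refl
μ-entry-injective {true}  {true}  _ _ _ = refl
μ-entry-injective {false} {true}  i j e = ⊥-elim (Bool.not-¬ refl (trans e (μ-entry-complement i j)))
μ-entry-injective {true}  {false} i j e = ⊥-elim (Bool.not-¬ refl (trans (sym e) (μ-entry-complement i j)))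

μ-image : ∀ {m n} (r s : Fin 3) → Matrix m n → ℕ → ℕ → Bool
μ-image r s q i j = μ-entry (entry q ((toℕ r + i) / 3) ((toℕ s + j) / 3)) (toℕ r + i) (toℕ s + j)

-- The m × n window at offset (r, s) of μ(q), for the smallest q whose image contains it.
μ-window : (r s : Fin 3) (m n : ℕ) → Matrix ⌈ toℕ r + m /3⌉ ⌈ toℕ s + n /3⌉ → Matrix m n
μ-window r s m n q = matrix m n (μ-image r s q)

window-expansion : ∀ k a b (r s : Fin 3) m n →
  window (suc k) (a * 3 + toℕ r) (b * 3 + toℕ s) m n ≡ μ-window r s m n (window k a b ⌈ toℕ r + m /3⌉ ⌈ toℕ s + n /3⌉)
window-expansion k a b r s m n =
  matrix-cong (λ i j → T (suc k) (a * 3 + toℕ r + i) (b * 3 + toℕ s + j)) (μ-image r s preimage) λ {i} {j} i<m j<n → begin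
    T (suc k) (a * 3 + toℕ r + i) (b * 3 + toℕ s + j)
      ≡⟨ cong₂ (T (suc k)) (+-assoc (a * 3) (toℕ r) i) (+-assoc (b * 3) (toℕ s) j) ⟩
    T (suc k) (a * 3 + (toℕ r + i)) (b * 3 + (toℕ s + j))
      ≡⟨ T-expansion k a b (toℕ r + i) (toℕ s + j) ⟩
    μ-entry (T k (a + (toℕ r + i) / 3) (b + (toℕ s + j) / 3)) (toℕ r + i) (toℕ s + j)
      ≡⟨ cong (λ x → μ-entry x (toℕ r + i) (toℕ s + j)) (entry-matrix (λ i j → T k (a + i) (b + j))
           (x<y⇒x/3<⌈y/3⌉ (+-monoʳ-< (toℕ r) i<m)) (x<y⇒x/3<⌈y/3⌉ (+-monoʳ-< (toℕ s) j<n))) ⟨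
    μ-image r s preimage i j
      ∎
  where
  open ≡-Reasoning
  preimage : Matrix ⌈ toℕ r + m /3⌉ ⌈ toℕ s + n /3⌉
  preimage = window k a b ⌈ toℕ r + m /3⌉ ⌈ toℕ s + n /3⌉

window-split : ∀ k a b m n →
  window (suc k) a b m n ≡
  μ-window (a mod 3) (b mod 3) m n (window k (a / 3) (b / 3) ⌈ toℕ (a mod 3) + m /3⌉ ⌈ toℕ (b mod 3) + n /3⌉)
window-split k a b m n =
  trans (cong₂ (λ a b → window (suc k) a b m n) (mod3-decomposition a) (mod3-decomposition b))
        (window-expansion k (a / 3) (b / 3) (a mod 3) (b mod 3) m n)

window-split-bound : ∀ k a m → a + m ≤ 3 ^ suc k → a / 3 + ⌈ toℕ (a mod 3) + m /3⌉ ≤ 3 ^ k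
window-split-bound k a m h =
  preimage-bound (toℕ (a mod 3)) (a / 3) m (3 ^ k) (subst (λ x → x + m ≤ 3 ^ suc k) (mod3-decomposition a) h)

μ-window-occurs : ∀ r s m n {q} → Occurs q → Occurs (μ-window r s m n q)
μ-window-occurs r s m n (k , a , b , a-bound , b-bound , refl) =
  suc k , a * 3 + toℕ r , b * 3 + toℕ s ,
  expansion-bound (toℕ r) a m _ a-bound , expansion-bound (toℕ s) b n _ b-bound ,
  sym (window-expansion k a b r s m n)

μ-window-injective : ∀ r s {m n} → 1 ≤ m → 1 ≤ n → ∀ {q q′} → μ-window r s m n q ≡ μ-window r s m n q′ → q ≡ q′
μ-window-injective r s {m} {n} 1≤m 1≤n {q} {q′} eq = matrix-ext q q′ agree
  where
  read : ∀ {i j} → i < m → j < n →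
    entry q ((toℕ r + i) / 3) ((toℕ s + j) / 3) ≡ entry q′ ((toℕ r + i) / 3) ((toℕ s + j) / 3)
  read {i} {j} i<m j<n = μ-entry-injective (toℕ r + i) (toℕ s + j) (begin
    μ-image r s q i j                ≡⟨ entry-matrix (μ-image r s q) i<m j<n ⟨
    entry (μ-window r s m n q) i j   ≡⟨ cong (λ M → entry M i j) eq ⟩
    entry (μ-window r s m n q′) i j  ≡⟨ entry-matrix (μ-image r s q′) i<m j<n ⟩
    μ-image r s q′ i j               ∎)
    where open ≡-Reasoning
  agree : ∀ {i′ j′} → i′ < ⌈ toℕ r + m /3⌉ → j′ < ⌈ toℕ s + n /3⌉ → entry q i′ j′ ≡ entry q′ i′ j′
  agree i′<c j′<c with [r+i]/3-onto (toℕ r) m (toℕ≤2 r) 1≤m i′<c | [r+i]/3-onto (toℕ s) n (toℕ≤2 s) 1≤n j′<c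
  ... | i , i<m , refl | j , j<n , refl = read i<m j<n

crop-μ-window : ∀ r s {m n m′ n′} → m′ ≤ m → n′ ≤ n → (q : Matrix ⌈ toℕ r + m /3⌉ ⌈ toℕ s + n /3⌉) →
  crop m′ n′ (μ-window r s m n q) ≡ μ-window r s m′ n′ (crop _ _ q)
crop-μ-window r s {m} {n} {m′} {n′} m′≤m n′≤n q =
  matrix-cong (entry (μ-window r s m n q)) (μ-image r s (crop ⌈ toℕ r + m′ /3⌉ ⌈ toℕ s + n′ /3⌉ q)) λ {i} {j} i<m′ j<n′ → trans
    (entry-matrix (μ-image r s q) (<-≤-trans i<m′ m′≤m) (<-≤-trans j<n′ n′≤n))
    (cong (λ x → μ-entry x (toℕ r + i) (toℕ s + j))
      (sym (entry-matrix (entry q) (x<y⇒x/3<⌈y/3⌉ (+-monoʳ-< (toℕ r) i<m′)) (x<y⇒x/3<⌈y/3⌉ (+-monoʳ-< (toℕ s) j<n′)))))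

vectors : {X : Set} → List X → (n : ℕ) → List (Vec X n)
vectors xs zero    = Vec.[] ∷ []
vectors xs (suc n) = cartesianProductWith Vec._∷_ xs (vectors xs n)

∈-vectors : {X : Set} {xs : List X} → (∀ x → x ∈ xs) → ∀ {n} (v : Vec X n) → v ∈ vectors xs n
∈-vectors every Vec.[]      = here refl
∈-vectors every (x Vec.∷ v) = ∈-cartesianProductWith⁺ Vec._∷_ (every x) (∈-vectors every v)

matrices : (m n : ℕ) → List (Matrix m n)
matrices m n = vectors (vectors (false ∷ true ∷ []) n) m

∈-matrices : ∀ {m n} (M : Matrix m n) → M ∈ matrices m n
∈-matrices = ∈-vectors (∈-vectors λ { false → here refl ; true → there (here refl) })

_≟ₘ_ : ∀ {m n} → DecidableEquality (Matrix m n)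
_≟ₘ_ = Vec-≡-dec (Vec-≡-dec Bool._≟_)

corners-determine-offset : ∀ r s r′ s′ →
  All (λ q → All (λ q′ → μ-window r s 4 4 q ≡ μ-window r′ s′ 4 4 q′ → (r , s) ≡ (r′ , s′)) (matrices _ _)) (matrices _ _)
corners-determine-offset = toWitness {a? = all? λ r → all? λ s → all? λ r′ → all? λ s′ →
  All.all? (λ q → All.all? (λ q′ → (μ-window r s 4 4 q ≟ₘ μ-window r′ s′ 4 4 q′) →-dec ×-≡-dec _≟ᶠ_ _≟ᶠ_ (r , s) (r′ , s′))
                           (matrices _ _))
           (matrices _ _)} _

μ-window-recognisable : ∀ {r s r′ s′ m n q q′} → 4 ≤ m → 4 ≤ n →
  μ-window r s m n q ≡ μ-window r′ s′ m n q′ → (r , s) ≡ (r′ , s′)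
μ-window-recognisable {r} {s} {r′} {s′} {m} {n} {q} {q′} 4≤m 4≤n eq =
  All.lookup (All.lookup (corners-determine-offset r s r′ s′) (∈-matrices corner)) (∈-matrices corner′) (begin
    μ-window r s 4 4 corner            ≡⟨ crop-μ-window r s 4≤m 4≤n q ⟨
    crop 4 4 (μ-window r s m n q)      ≡⟨ cong (crop 4 4) eq ⟩
    crop 4 4 (μ-window r′ s′ m n q′)   ≡⟨ crop-μ-window r′ s′ 4≤m 4≤n q′ ⟩
    μ-window r′ s′ 4 4 corner′         ∎)
  where
  open ≡-Reasoning
  corner : Matrix ⌈ toℕ r + 4 /3⌉ ⌈ toℕ s + 4 /3⌉
  corner = crop _ _ q
  corner′ : Matrix ⌈ toℕ r′ + 4 /3⌉ ⌈ toℕ s′ + 4 /3⌉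
  corner′ = crop _ _ q′

-- Sizes and the table of small patterns

offsets : List (Fin 3 × Fin 3)
offsets = cartesianProduct (allFin 3) (allFin 3)

∈-offsets : ∀ r s → (r , s) ∈ offsets
∈-offsets r s = ∈-cartesianProduct⁺ (∈-allFin r) (∈-allFin s)

Big : ℕ → ℕ → Set
Big m n = 4 ≤ m × 4 ≤ n

big? : ∀ m n → Dec (Big m n)
big? m n = 4 ≤? m ×-dec 4 ≤? n

-- The sizes reached from square ones by passing to preimages.
NearSquare : ℕ → ℕ → Set
NearSquare m n = 1 ≤ m × 1 ≤ n × m ≤ suc n × n ≤ suc m

nearSquare? : ∀ m n → Dec (NearSquare m n)
nearSquare? m n = 1 ≤? m ×-dec 1 ≤? n ×-dec m ≤? suc n ×-dec n ≤? suc m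

preimage-near-square : ∀ {m n} → NearSquare m n → (r s : Fin 3) → NearSquare ⌈ toℕ r + m /3⌉ ⌈ toℕ s + n /3⌉
preimage-near-square (1≤m , 1≤n , m≤1+n , n≤1+m) r s =
  preimage-positive (toℕ r) 1≤m , preimage-positive (toℕ s) 1≤n ,
  preimage-near (toℕ s) (toℕ≤2 r) m≤1+n , preimage-near (toℕ r) (toℕ≤2 s) n≤1+m

preimage-not-big : ∀ {m n} → ¬ Big m n → (r s : Fin 3) → ¬ Big ⌈ toℕ r + m /3⌉ ⌈ toℕ s + n /3⌉
preimage-not-big ¬big r s (4≤c , 4≤d) =
  ¬big (≮⇒≥ (λ m<4 → <⇒≱ (preimage-small (toℕ≤2 r) m<4) 4≤c) , ≮⇒≥ (λ n<4 → <⇒≱ (preimage-small (toℕ≤2 s) n<4) 4≤d))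

preimage-fuel : ∀ {m f} (r : Fin 3) → 4 ≤ m → m ≤ suc f → ⌈ toℕ r + m /3⌉ ≤ f
preimage-fuel r 4≤m m≤1+f = ≤-pred (≤-trans (preimage-smaller (toℕ≤2 r) 4≤m) m≤1+f)

4≤m⇒m≰0 : ∀ {m} → 4 ≤ m → ¬ m ≤ 0
4≤m⇒m≰0 4≤m = <⇒≱ (≤-trans (s≤s z≤n) 4≤m)

BaseSize : ℕ × ℕ → Set
BaseSize (m , n) = NearSquare m n × ¬ Big m n

baseSize? : Decidable BaseSize
baseSize? (m , n) = nearSquare? m n ×-dec ¬? (big? m n)

baseSizes : List (ℕ × ℕ)
baseSizes = filter baseSize? (cartesianProduct (upTo 5) (upTo 5))

∈-baseSizes : ∀ {m n} → NearSquare m n → ¬ Big m n → (m , n) ∈ baseSizes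
∈-baseSizes {m} {n} near@(_ , _ , m≤1+n , n≤1+m) ¬big =
  ∈-filter⁺ baseSize? (∈-cartesianProduct⁺ (∈-upTo⁺ (proj₁ bounds)) (∈-upTo⁺ (proj₂ bounds))) (near , ¬big)
  where
  bounds : m < 5 × n < 5
  bounds with m <? 4 | n <? 4
  ... | yes m<4 | _       = m<n⇒m<1+n m<4 , s≤s (≤-trans n≤1+m m<4)
  ... | no _    | yes n<4 = s≤s (≤-trans m≤1+n n<4) , m<n⇒m<1+n n<4
  ... | no m≮4  | no n≮4  = ⊥-elim (¬big (≮⇒≥ m≮4 , ≮⇒≥ n≮4))

-- One occurrence in T₄ of every pattern of each base size. That the table is complete follows
-- by induction on k from its closure under expansion, which tables-certified checks.
positions : ℕ → ℕ → List (ℕ × ℕ)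
positions 1 1 = (0 , 0) ∷ (0 , 1) ∷ []
positions 1 2 = (0 , 0) ∷ (0 , 1) ∷ (1 , 0) ∷ (1 , 3) ∷ []
positions 2 1 = (0 , 0) ∷ (0 , 1) ∷ (0 , 3) ∷ (0 , 4) ∷ []
positions 2 2 = (0 , 0) ∷ (0 , 1) ∷ (0 , 2) ∷ (0 , 3) ∷ (0 , 4) ∷ (0 , 5) ∷ (1 , 0) ∷ (1 , 1) ∷ (1 , 3) ∷ (1 , 4) ∷ (2 , 3) ∷ (2 , 4) ∷ (3 , 2) ∷ (3 , 11) ∷ []
positions 2 3 = (0 , 0) ∷ (0 , 1) ∷ (0 , 2) ∷ (0 , 3) ∷ (0 , 4) ∷ (0 , 5) ∷ (1 , 0) ∷ (1 , 1) ∷ (1 , 2) ∷ (1 , 3) ∷ (1 , 4) ∷ (1 , 5) ∷ (2 , 0) ∷ (2 , 2) ∷ (2 , 3) ∷ (2 , 4) ∷ (2 , 7) ∷ (2 , 11) ∷ (2 , 12) ∷ (2 , 13) ∷ (3 , 1) ∷ (3 , 2) ∷ (3 , 10) ∷ (3 , 11) ∷ (4 , 1) ∷ (4 , 2) ∷ (4 , 10) ∷ (4 , 11) ∷ (5 , 2) ∷ (5 , 4) ∷ (5 , 11) ∷ (5 , 13) ∷ (11 , 7) ∷ (11 , 8) ∷ (11 , 34) ∷ (11 , 35) ∷ []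
positions 3 2 = (0 , 0) ∷ (0 , 1) ∷ (0 , 2) ∷ (0 , 3) ∷ (0 , 4) ∷ (0 , 5) ∷ (1 , 0) ∷ (1 , 1) ∷ (1 , 2) ∷ (1 , 3) ∷ (1 , 4) ∷ (1 , 5) ∷ (1 , 9) ∷ (1 , 10) ∷ (1 , 11) ∷ (1 , 12) ∷ (1 , 13) ∷ (1 , 14) ∷ (2 , 2) ∷ (2 , 3) ∷ (2 , 4) ∷ (2 , 5) ∷ (2 , 11) ∷ (2 , 12) ∷ (2 , 13) ∷ (2 , 14) ∷ (3 , 2) ∷ (3 , 11) ∷ (4 , 2) ∷ (4 , 5) ∷ (4 , 11) ∷ (4 , 14) ∷ (7 , 11) ∷ (7 , 14) ∷ (8 , 11) ∷ (8 , 14) ∷ []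
positions 3 3 = (0 , 0) ∷ (0 , 1) ∷ (0 , 2) ∷ (0 , 3) ∷ (0 , 4) ∷ (0 , 5) ∷ (1 , 0) ∷ (1 , 1) ∷ (1 , 2) ∷ (1 , 3) ∷ (1 , 4) ∷ (1 , 5) ∷ (1 , 7) ∷ (1 , 8) ∷ (1 , 9) ∷ (1 , 10) ∷ (1 , 11) ∷ (1 , 12) ∷ (1 , 13) ∷ (1 , 14) ∷ (1 , 16) ∷ (1 , 17) ∷ (2 , 0) ∷ (2 , 1) ∷ (2 , 2) ∷ (2 , 3) ∷ (2 , 4) ∷ (2 , 5) ∷ (2 , 7) ∷ (2 , 8) ∷ (2 , 9) ∷ (2 , 10) ∷ (2 , 11) ∷ (2 , 12) ∷ (2 , 13) ∷ (2 , 14) ∷ (2 , 16) ∷ (2 , 17) ∷ (3 , 1) ∷ (3 , 2) ∷ (3 , 10) ∷ (3 , 11) ∷ (4 , 1) ∷ (4 , 2) ∷ (4 , 4) ∷ (4 , 5) ∷ (4 , 10) ∷ (4 , 11) ∷ (4 , 13) ∷ (4 , 14) ∷ (5 , 2) ∷ (5 , 4) ∷ (5 , 11) ∷ (5 , 13) ∷ (7 , 10) ∷ (7 , 11) ∷ (7 , 13) ∷ (7 , 14) ∷ (8 , 10) ∷ (8 , 11) ∷ (8 , 13) ∷ (8 , 14) ∷ (10 , 7) ∷ (10 , 8) ∷ (10 , 34) ∷ (10 , 35) ∷ (11 , 7) ∷ (11 , 8) ∷ (11 , 34) ∷ (11 , 35) ∷ []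
positions 3 4 = (0 , 0) ∷ (0 , 1) ∷ (0 , 2) ∷ (0 , 3) ∷ (0 , 4) ∷ (0 , 5) ∷ (1 , 0) ∷ (1 , 1) ∷ (1 , 2) ∷ (1 , 3) ∷ (1 , 4) ∷ (1 , 5) ∷ (1 , 6) ∷ (1 , 7) ∷ (1 , 8) ∷ (1 , 9) ∷ (1 , 10) ∷ (1 , 11) ∷ (1 , 12) ∷ (1 , 13) ∷ (1 , 14) ∷ (1 , 15) ∷ (1 , 16) ∷ (1 , 17) ∷ (2 , 0) ∷ (2 , 1) ∷ (2 , 2) ∷ (2 , 3) ∷ (2 , 4) ∷ (2 , 5) ∷ (2 , 6) ∷ (2 , 7) ∷ (2 , 8) ∷ (2 , 9) ∷ (2 , 10) ∷ (2 , 11) ∷ (2 , 12) ∷ (2 , 13) ∷ (2 , 14) ∷ (2 , 15) ∷ (2 , 16) ∷ (2 , 17) ∷ (3 , 0) ∷ (3 , 1) ∷ (3 , 2) ∷ (3 , 9) ∷ (3 , 10) ∷ (3 , 11) ∷ (4 , 0) ∷ (4 , 1) ∷ (4 , 2) ∷ (4 , 3) ∷ (4 , 4) ∷ (4 , 5) ∷ (4 , 9) ∷ (4 , 10) ∷ (4 , 11) ∷ (4 , 12) ∷ (4 , 13) ∷ (4 , 14) ∷ (5 , 0) ∷ (5 , 1) ∷ (5 , 2) ∷ (5 , 3) ∷ (5 , 4) ∷ (5 , 5) ∷ (5 , 9) ∷ (5 , 10) ∷ (5 , 11) ∷ (5 , 12) ∷ (5 , 13) ∷ (5 , 14) ∷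 (7 , 9) ∷ (7 , 10) ∷ (7 , 11) ∷ (7 , 12) ∷ (7 , 13) ∷ (7 , 14) ∷ (8 , 9) ∷ (8 , 10) ∷ (8 , 11) ∷ (8 , 12) ∷ (8 , 13) ∷ (8 , 14) ∷ (10 , 6) ∷ (10 , 7) ∷ (10 , 8) ∷ (10 , 33) ∷ (10 , 34) ∷ (10 , 35) ∷ (11 , 6) ∷ (11 , 7) ∷ (11 , 8) ∷ (11 , 33) ∷ (11 , 34) ∷ (11 , 35) ∷ []
positions 4 3 = (0 , 0) ∷ (0 , 1) ∷ (0 , 2) ∷ (0 , 3) ∷ (0 , 4) ∷ (0 , 5) ∷ (0 , 7) ∷ (0 , 8) ∷ (0 , 9) ∷ (0 , 10) ∷ (0 , 11) ∷ (0 , 12) ∷ (0 , 13) ∷ (0 , 14) ∷ (0 , 16) ∷ (0 , 17) ∷ (1 , 0) ∷ (1 , 1) ∷ (1 , 2) ∷ (1 , 3) ∷ (1 , 4) ∷ (1 , 5) ∷ (1 , 7) ∷ (1 , 8) ∷ (1 , 9) ∷ (1 , 10) ∷ (1 , 11) ∷ (1 , 12) ∷ (1 , 13) ∷ (1 , 14) ∷ (1 , 16) ∷ (1 , 17) ∷ (2 , 0) ∷ (2 , 1) ∷ (2 , 2) ∷ (2 , 3) ∷ (2 , 4) ∷ (2 , 5) ∷ (2 , 7) ∷ (2 , 8) ∷ (2 , 9) ∷ (2 , 10) ∷ (2 , 11) ∷ (2 , 12) ∷ (2 , 13) ∷ (2 , 14) ∷ (2 , 16) ∷ (2 , 17) ∷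 (3 , 1) ∷ (3 , 2) ∷ (3 , 4) ∷ (3 , 5) ∷ (3 , 10) ∷ (3 , 11) ∷ (3 , 13) ∷ (3 , 14) ∷ (4 , 1) ∷ (4 , 2) ∷ (4 , 4) ∷ (4 , 5) ∷ (4 , 10) ∷ (4 , 11) ∷ (4 , 13) ∷ (4 , 14) ∷ (5 , 1) ∷ (5 , 2) ∷ (5 , 4) ∷ (5 , 5) ∷ (5 , 10) ∷ (5 , 11) ∷ (5 , 13) ∷ (5 , 14) ∷ (6 , 10) ∷ (6 , 11) ∷ (6 , 13) ∷ (6 , 14) ∷ (7 , 10) ∷ (7 , 11) ∷ (7 , 13) ∷ (7 , 14) ∷ (8 , 10) ∷ (8 , 11) ∷ (8 , 13) ∷ (8 , 14) ∷ (9 , 7) ∷ (9 , 8) ∷ (9 , 34) ∷ (9 , 35) ∷ (10 , 7) ∷ (10 , 8) ∷ (10 , 34) ∷ (10 , 35) ∷ (11 , 7) ∷ (11 , 8) ∷ (11 , 34) ∷ (11 , 35) ∷ []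
positions _ _ = []

window₄ : (m n : ℕ) → ℕ × ℕ → Matrix m n
window₄ m n (a , b) = window 4 a b m n

table : (m n : ℕ) → List (Matrix m n)
table m n = map (window₄ m n) (positions m n)

InsideT₄ : (m n : ℕ) → ℕ × ℕ → Set
InsideT₄ m n (a , b) = a + m ≤ 3 ^ 4 × b + n ≤ 3 ^ 4

ClosedUnderExpansion : (m n : ℕ) → Fin 3 × Fin 3 → Set
ClosedUnderExpansion m n (r , s) = All (λ q → μ-window r s m n q ∈ table m n) (table ⌈ toℕ r + m /3⌉ ⌈ toℕ s + n /3⌉)

TableCertificate : ℕ × ℕ → Set
TableCertificate (m , n) = Unique (table m n) × All (InsideT₄ m n) (positions m n) × All (ClosedUnderExpansion m n) offsets

certificate? : Decidable TableCertificate
certificate? (m , n) =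
  AllPairs.allPairs? (λ M N → ¬? (M ≟ₘ N)) (table m n) ×-dec
  All.all? (λ (a , b) → a + m ≤? 3 ^ 4 ×-dec b + n ≤? 3 ^ 4) (positions m n) ×-dec
  All.all? (λ (r , s) → All.all? (λ q → Any.any? (μ-window r s m n q ≟ₘ_) (table m n)) (table _ _)) offsets

tables-certified : All TableCertificate baseSizes
tables-certified = toWitness {a? = All.all? certificate? baseSizes} _

certificate : ∀ {m n} → NearSquare m n → ¬ Big m n → TableCertificate (m , n)
certificate near ¬big = All.lookup tables-certified (∈-baseSizes near ¬big)

table-occurs : ∀ {m n} → All (InsideT₄ m n) (positions m n) → All Occurs (table m n)
table-occurs = All.map⁺ ∘′ All.map λ { {a , b} (a-bound , b-bound) → 4 , a , b , a-bound , b-bound , refl }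

unit-window : ∀ {a m} → 1 ≤ m → a + m ≤ 1 → a ≡ 0 × m ≡ 1
unit-window {a} {m} 1≤m a+m≤1 =
  n≤0⇒n≡0 (+-cancelʳ-≤ 1 a 0 (≤-trans (+-monoʳ-≤ a 1≤m) a+m≤1)) ,
  ≤-antisym (≤-trans (m≤n+m m a) a+m≤1) 1≤m

table-complete : ∀ k {m n a b} → NearSquare m n → ¬ Big m n → a + m ≤ 3 ^ k → b + n ≤ 3 ^ k → window k a b m n ∈ table m n
table-complete zero (1≤m , 1≤n , _) _ a-bound b-bound
  with unit-window 1≤m a-bound | unit-window 1≤n b-bound
... | refl , refl | refl , refl = here refl
table-complete (suc k) {m} {n} {a} {b} near ¬big a-bound b-bound =
  subst (_∈ table m n) (sym (window-split k a b m n))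
    (All.lookup (All.lookup (proj₂ (proj₂ (certificate near ¬big))) (∈-offsets r s))
      (table-complete k (preimage-near-square near r s) (preimage-not-big ¬big r s)
        (window-split-bound k a m a-bound) (window-split-bound k b n b-bound)))
  where
  r s : Fin 3
  r = a mod 3
  s = b mod 3

-- Enumerating the patterns

patterns : (fuel m n : ℕ) → List (Matrix m n)
expansions : (fuel m n : ℕ) → Fin 3 × Fin 3 → List (Matrix m n)

patterns zero    m n = table m n
patterns (suc f) m n with big? m n
... | yes _ = concatMap (expansions f m n) offsets
... | no  _ = table m n

expansions f m n (r , s) = map (μ-window r s m n) (patterns f ⌈ toℕ r + m /3⌉ ⌈ toℕ s + n /3⌉)

patterns-small : ∀ f {m n} → ¬ Big m n → patterns f m n ≡ table m n
patterns-small zero    _ = refl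
patterns-small (suc f) {m} {n} ¬big with big? m n
... | yes big = ⊥-elim (¬big big)
... | no  _   = refl

patterns-big : ∀ f {m n} → Big m n → patterns (suc f) m n ≡ concatMap (expansions f m n) offsets
patterns-big f {m} {n} big with big? m n
... | yes _    = refl
... | no ¬big = ⊥-elim (¬big big)

expansions-disjoint : ∀ f {m n} → Big m n → ∀ {o o′} → o ≢ o′ → Disjoint (expansions f m n o) (expansions f m n o′)
expansions-disjoint f (4≤m , 4≤n) {r , s} {r′ , s′} o≢o′ (M∈ , M∈′)
  with ∈-map⁻ (μ-window r s _ _) M∈ | ∈-map⁻ (μ-window r′ s′ _ _) M∈′
... | q , _ , refl | q′ , _ , eq = o≢o′ (μ-window-recognisable {q = q} {q′} 4≤m 4≤n eq)

patterns-unique : ∀ f {m n} → NearSquare m n → m ≤ f → Unique (patterns f m n)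
patterns-unique f {m} {n} near m≤f with big? m n
... | no ¬big = subst Unique (sym (patterns-small f ¬big)) (proj₁ (certificate near ¬big))
patterns-unique zero    near m≤0 | yes (4≤m , _) = ⊥-elim (4≤m⇒m≰0 4≤m m≤0)
patterns-unique (suc f) {m} {n} near@(1≤m , 1≤n , _) m≤f | yes big@(4≤m , _) =
  subst Unique (sym (patterns-big f big))
    (Unique.concat⁺ (All.map⁺ (All.universal expansion-unique offsets))
                    (AllPairs.map⁺ (AllPairs.map (expansions-disjoint f big) offsets-unique)))
  where
  offsets-unique : Unique offsets
  offsets-unique = Unique.cartesianProduct⁺ (Unique.allFin⁺ 3) (Unique.allFin⁺ 3)
  expansion-unique : ∀ o → Unique (expansions f m n o)
  expansion-unique (r , s) = Unique.map⁺ (μ-window-injective r s 1≤m 1≤n)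
    (patterns-unique f (preimage-near-square near r s) (preimage-fuel r 4≤m m≤f))

patterns-occur : ∀ f {m n} → NearSquare m n → m ≤ f → All Occurs (patterns f m n)
patterns-occur f {m} {n} near m≤f with big? m n
... | no ¬big = subst (All Occurs) (sym (patterns-small f ¬big)) (table-occurs (proj₁ (proj₂ (certificate near ¬big))))
patterns-occur zero    near m≤0 | yes (4≤m , _) = ⊥-elim (4≤m⇒m≰0 4≤m m≤0)
patterns-occur (suc f) {m} {n} near m≤f | yes big@(4≤m , _) =
  subst (All Occurs) (sym (patterns-big f big)) (All.concat⁺ (All.map⁺ (All.universal expansion-occurs offsets)))
  where
  expansion-occurs : ∀ o → All Occurs (expansions f m n o)
  expansion-occurs (r , s) = All.map⁺ (All.map (μ-window-occurs r s m n)
    (patterns-occur f (preimage-near-square near r s) (preimage-fuel r 4≤m m≤f)))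

patterns-complete : ∀ k f {m n a b} → NearSquare m n → m ≤ f → a + m ≤ 3 ^ k → b + n ≤ 3 ^ k →
  window k a b m n ∈ patterns f m n
patterns-complete k f {m} {n} {a} {b} near m≤f a-bound b-bound with big? m n
... | no ¬big = subst (window k a b m n ∈_) (sym (patterns-small f ¬big)) (table-complete k near ¬big a-bound b-bound)
patterns-complete k zero near m≤0 _ _ | yes (4≤m , _) = ⊥-elim (4≤m⇒m≰0 4≤m m≤0)
patterns-complete zero (suc f) {a = a} near m≤f a-bound _ | yes (4≤m , _) =
  ⊥-elim (<⇒≱ (s≤s (s≤s z≤n)) (≤-trans (≤-trans 4≤m (m≤n+m _ a)) a-bound))
patterns-complete (suc k) (suc f) {m} {n} {a} {b} near m≤f a-bound b-bound | yes big@(4≤m , _) =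
  subst₂ _∈_ (sym (window-split k a b m n)) (sym (patterns-big f big))
    (∈-concat⁺′ (∈-map⁺ (μ-window r s m n)
                   (patterns-complete k f (preimage-near-square near r s) (preimage-fuel r 4≤m m≤f)
                     (window-split-bound k a m a-bound) (window-split-bound k b n b-bound)))
                (∈-map⁺ (expansions f m n) (∈-offsets r s)))
  where
  r s : Fin 3
  r = a mod 3
  s = b mod 3

patterns-fuel : ∀ f f′ {m n} → m ≤ f → m ≤ f′ → patterns f m n ≡ patterns f′ m n
patterns-fuel f f′ {m} {n} m≤f m≤f′ with big? m n
... | no ¬big = trans (patterns-small f ¬big) (sym (patterns-small f′ ¬big))
patterns-fuel zero    _        m≤0 _   | yes (4≤m , _) = ⊥-elim (4≤m⇒m≰0 4≤m m≤0)
patterns-fuel (suc f) zero     _   m≤0 | yes (4≤m , _) = ⊥-elim (4≤m⇒m≰0 4≤m m≤0)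
patterns-fuel (suc f) (suc f′) {m} {n} m≤f m≤f′ | yes big@(4≤m , _) = begin
  patterns (suc f) m n                    ≡⟨ patterns-big f big ⟩
  concatMap (expansions f m n) offsets    ≡⟨ cong concat (map-cong expansions-fuel offsets) ⟩
  concatMap (expansions f′ m n) offsets   ≡⟨ patterns-big f′ big ⟨
  patterns (suc f′) m n                   ∎
  where
  open ≡-Reasoning
  expansions-fuel : ∀ o → expansions f m n o ≡ expansions f′ m n o
  expansions-fuel (r , s) =
    cong (map (μ-window r s m n)) (patterns-fuel f f′ (preimage-fuel r 4≤m m≤f) (preimage-fuel r 4≤m m≤f′))

length-concat : {X : Set} (xss : List (List X)) → length (concat xss) ≡ sum (map length xss)
length-concat []         = refl
length-concat (xs ∷ xss) = trans (length-++ xs) (cong (λ k → length xs + k) (length-concat xss))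

sum-cartesianProduct : {X Y : Set} (g : X × Y → ℕ) (xs : List X) (ys : List Y) →
  sum (map g (cartesianProduct xs ys)) ≡ sum (map (λ x → sum (map (λ y → g (x , y)) ys)) xs)
sum-cartesianProduct g []       ys = refl
sum-cartesianProduct g (x ∷ xs) ys = begin
  sum (map g (map (x ,_) ys ++ cartesianProduct xs ys))
    ≡⟨ cong sum (map-++ g (map (x ,_) ys) _) ⟩
  sum (map g (map (x ,_) ys) ++ map g (cartesianProduct xs ys))
    ≡⟨ sum-++ (map g (map (x ,_) ys)) _ ⟩
  sum (map g (map (x ,_) ys)) + sum (map g (cartesianProduct xs ys))
    ≡⟨ cong₂ _+_ (cong sum (sym (map-∘ ys))) (sum-cartesianProduct g xs ys) ⟩
  sum (map (λ y → g (x , y)) ys) + sum (map (λ x → sum (map (λ y → g (x , y)) ys)) xs) ∎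
  where open ≡-Reasoning

Σ₃ : (Fin 3 → ℕ) → ℕ
Σ₃ g = sum (map g (allFin 3))

Σ₃-cong : ∀ {g h} → (∀ r → g r ≡ h r) → Σ₃ g ≡ Σ₃ h
Σ₃-cong eq = cong sum (map-cong eq (allFin 3))

count : ℕ → ℕ → ℕ
count m n = length (patterns m m n)

count-split : ∀ {m n} → Big m n → count m n ≡ Σ₃ λ r → Σ₃ λ s → count ⌈ toℕ r + m /3⌉ ⌈ toℕ s + n /3⌉
count-split {suc f} {n} big@(4≤m , _) = begin
  length (patterns (suc f) (suc f) n)
    ≡⟨ cong length (patterns-big f big) ⟩
  length (concatMap (expansions f (suc f) n) offsets)
    ≡⟨ length-concat (map (expansions f (suc f) n) offsets) ⟩
  sum (map length (map (expansions f (suc f) n) offsets))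
    ≡⟨ cong sum (map-∘ {g = length} {f = expansions f (suc f) n} offsets) ⟨
  sum (map (length ∘ expansions f (suc f) n) offsets)
    ≡⟨ cong sum (map-cong expansion-count offsets) ⟩
  sum (map (λ (r , s) → count ⌈ toℕ r + suc f /3⌉ ⌈ toℕ s + n /3⌉) offsets)
    ≡⟨ sum-cartesianProduct (λ (r , s) → count ⌈ toℕ r + suc f /3⌉ ⌈ toℕ s + n /3⌉) (allFin 3) (allFin 3) ⟩
  (Σ₃ λ r → Σ₃ λ s → count ⌈ toℕ r + suc f /3⌉ ⌈ toℕ s + n /3⌉) ∎
  where
  open ≡-Reasoning
  expansion-count : ∀ o → length (expansions f (suc f) n o) ≡ count ⌈ toℕ (proj₁ o) + suc f /3⌉ ⌈ toℕ (proj₂ o) + n /3⌉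
  expansion-count (r , s) =
    trans (length-map (μ-window r s (suc f) n) (patterns f ⌈ toℕ r + suc f /3⌉ ⌈ toℕ s + n /3⌉))
          (cong length (patterns-fuel f _ (preimage-fuel r 4≤m ≤-refl) ≤-refl))

Σ₃-ceil : ∀ t → 1 ≤ t → t ≤ 4 → (g : ℕ → ℕ) → (Σ₃ λ r → g ⌈ toℕ r + t /3⌉) ≡ (4 ∸ t) * g 1 + (t ∸ 1) * g 2
Σ₃-ceil 1 _ _ g = weights (g 1) (g 2)
  where
  weights : ∀ x y → x + (x + (x + 0)) ≡ 3 * x + 0 * y
  weights = ℕ-Ring.solve-∀
Σ₃-ceil 2 _ _ g = weights (g 1) (g 2)
  where
  weights : ∀ x y → x + (x + (y + 0)) ≡ 2 * x + 1 * y
  weights = ℕ-Ring.solve-∀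
Σ₃-ceil 3 _ _ g = weights (g 1) (g 2)
  where
  weights : ∀ x y → x + (y + (y + 0)) ≡ 1 * x + 2 * y
  weights = ℕ-Ring.solve-∀
Σ₃-ceil 4 _ _ g = weights (g 1) (g 2)
  where
  weights : ∀ x y → y + (y + (y + 0)) ≡ 0 * x + 3 * y
  weights = ℕ-Ring.solve-∀
Σ₃-ceil (suc (suc (suc (suc (suc _))))) _ (s≤s (s≤s (s≤s (s≤s ())))) _

count-weights : ∀ {t u p q} → 1 ≤ t → t ≤ 4 → 1 ≤ u → u ≤ 4 → 1 ≤ p → 1 ≤ q →
  count (t + p * 3) (u + q * 3) ≡
    (4 ∸ t) * (4 ∸ u) * count (1 + p) (1 + q) + (4 ∸ t) * (u ∸ 1) * count (1 + p) (2 + q) +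
    (t ∸ 1) * (4 ∸ u) * count (2 + p) (1 + q) + (t ∸ 1) * (u ∸ 1) * count (2 + p) (2 + q)
count-weights {t} {u} {p} {q} 1≤t t≤4 1≤u u≤4 1≤p 1≤q = begin
  count (t + p * 3) (u + q * 3)
    ≡⟨ count-split (big 1≤t 1≤p , big 1≤u 1≤q) ⟩
  (Σ₃ λ r → Σ₃ λ s → count ⌈ toℕ r + (t + p * 3) /3⌉ ⌈ toℕ s + (u + q * 3) /3⌉)
    ≡⟨ Σ₃-cong (λ r → Σ₃-cong λ s → cong₂ count (shift (toℕ r) t p) (shift (toℕ s) u q)) ⟩
  (Σ₃ λ r → Σ₃ λ s → count (⌈ toℕ r + t /3⌉ + p) (⌈ toℕ s + u /3⌉ + q))
    ≡⟨ Σ₃-cong (λ r → Σ₃-ceil u 1≤u u≤4 λ j → count (⌈ toℕ r + t /3⌉ + p) (j + q)) ⟩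
  (Σ₃ λ r → (4 ∸ u) * count (⌈ toℕ r + t /3⌉ + p) (1 + q) + (u ∸ 1) * count (⌈ toℕ r + t /3⌉ + p) (2 + q))
    ≡⟨ Σ₃-ceil t 1≤t t≤4 (λ i → (4 ∸ u) * count (i + p) (1 + q) + (u ∸ 1) * count (i + p) (2 + q)) ⟩
  (4 ∸ t) * ((4 ∸ u) * count (1 + p) (1 + q) + (u ∸ 1) * count (1 + p) (2 + q)) +
  (t ∸ 1) * ((4 ∸ u) * count (2 + p) (1 + q) + (u ∸ 1) * count (2 + p) (2 + q))
    ≡⟨ expand (4 ∸ t) (t ∸ 1) (4 ∸ u) (u ∸ 1) _ _ _ _ ⟩
  (4 ∸ t) * (4 ∸ u) * count (1 + p) (1 + q) + (4 ∸ t) * (u ∸ 1) * count (1 + p) (2 + q) +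
  (t ∸ 1) * (4 ∸ u) * count (2 + p) (1 + q) + (t ∸ 1) * (u ∸ 1) * count (2 + p) (2 + q) ∎
  where
  open ≡-Reasoning
  big : ∀ {t p} → 1 ≤ t → 1 ≤ p → 4 ≤ t + p * 3
  big 1≤t 1≤p = +-mono-≤ 1≤t (*-monoˡ-≤ 3 1≤p)
  shift : ∀ r t p → ⌈ r + (t + p * 3) /3⌉ ≡ ⌈ r + t /3⌉ + p
  shift r t p = trans (cong ⌈_/3⌉ (sym (+-assoc r t (p * 3)))) (⌈x+a*3/3⌉≡⌈x/3⌉+a (r + t) p)
  expand : ∀ α β γ δ a b c d → α * (γ * a + δ * b) + β * (γ * c + δ * d) ≡ α * γ * a + α * δ * b + β * γ * c + β * δ * d
  expand = ℕ-Ring.solve-∀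

pos-linear : ∀ α β γ δ a b c d → + (α * a + β * b + γ * c + δ * d) ≡ + α *ℤ + a +ℤ + β *ℤ + b +ℤ + γ *ℤ + c +ℤ + δ *ℤ + d
pos-linear α β γ δ a b c d =
  trans (pos-+ (α * a + β * b + γ * c) (δ * d)) (cong₂ _+ℤ_
    (trans (pos-+ (α * a + β * b) (γ * c)) (cong₂ _+ℤ_
      (trans (pos-+ (α * a) (β * b)) (cong₂ _+ℤ_ (pos-* α a) (pos-* β b)))
      (pos-* γ c)))
    (pos-* δ d))

count-weightsℤ : ∀ t u {p q} {t∈[1,4] : True (1 ≤? t ×-dec t ≤? 4)} {u∈[1,4] : True (1 ≤? u ×-dec u ≤? 4)} →
  1 ≤ p → 1 ≤ q →
  + count (t + p * 3) (u + q * 3) ≡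
    + ((4 ∸ t) * (4 ∸ u)) *ℤ + count (1 + p) (1 + q) +ℤ + ((4 ∸ t) * (u ∸ 1)) *ℤ + count (1 + p) (2 + q) +ℤ
    + ((t ∸ 1) * (4 ∸ u)) *ℤ + count (2 + p) (1 + q) +ℤ + ((t ∸ 1) * (u ∸ 1)) *ℤ + count (2 + p) (2 + q)
count-weightsℤ t u {p} {q} {t∈[1,4]} {u∈[1,4]} 1≤p 1≤q =
  trans (cong +_ (count-weights (proj₁ t-range) (proj₂ t-range) (proj₁ u-range) (proj₂ u-range) 1≤p 1≤q))
        (pos-linear ((4 ∸ t) * (4 ∸ u)) ((4 ∸ t) * (u ∸ 1)) ((t ∸ 1) * (4 ∸ u)) ((t ∸ 1) * (u ∸ 1))
                    (count (1 + p) (1 + q)) (count (1 + p) (2 + q)) (count (2 + p) (1 + q)) (count (2 + p) (2 + q)))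
  where
  t-range : 1 ≤ t × t ≤ 4
  t-range = toWitness t∈[1,4]
  u-range : 1 ≤ u × u ≤ 4
  u-range = toWitness u∈[1,4]

-- The recurrences

-- The weight vector of 2 + 3(d + 3p) is 2u + v, where u and v are those of 1 + d + 3p and 2 + d + 3p.
compose : ∀ u₁ u₂ v₁ v₂ a b b′ c {y x₁₁ x₁₂ x₂₁ x₂₂} →
  y   ≡ + 4 *ℤ x₁₁ +ℤ + 2 *ℤ x₁₂ +ℤ + 2 *ℤ x₂₁ +ℤ + 1 *ℤ x₂₂ →
  x₁₁ ≡ u₁ *ℤ u₁ *ℤ a +ℤ u₁ *ℤ u₂ *ℤ b +ℤ u₂ *ℤ u₁ *ℤ b′ +ℤ u₂ *ℤ u₂ *ℤ c →
  x₁₂ ≡ u₁ *ℤ v₁ *ℤ a +ℤ u₁ *ℤ v₂ *ℤ b +ℤ u₂ *ℤ v₁ *ℤ b′ +ℤ u₂ *ℤ v₂ *ℤ c →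
  x₂₁ ≡ v₁ *ℤ u₁ *ℤ a +ℤ v₁ *ℤ u₂ *ℤ b +ℤ v₂ *ℤ u₁ *ℤ b′ +ℤ v₂ *ℤ u₂ *ℤ c →
  x₂₂ ≡ v₁ *ℤ v₁ *ℤ a +ℤ v₁ *ℤ v₂ *ℤ b +ℤ v₂ *ℤ v₁ *ℤ b′ +ℤ v₂ *ℤ v₂ *ℤ c →
  y ≡ (+ 2 *ℤ u₁ +ℤ v₁) *ℤ (+ 2 *ℤ u₁ +ℤ v₁) *ℤ a +ℤ (+ 2 *ℤ u₁ +ℤ v₁) *ℤ (+ 2 *ℤ u₂ +ℤ v₂) *ℤ b +ℤ
      (+ 2 *ℤ u₂ +ℤ v₂) *ℤ (+ 2 *ℤ u₁ +ℤ v₁) *ℤ b′ +ℤ (+ 2 *ℤ u₂ +ℤ v₂) *ℤ (+ 2 *ℤ u₂ +ℤ v₂) *ℤ c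
compose u₁ u₂ v₁ v₂ a b b′ c refl refl refl refl refl = ℤ-Ring.solve (u₁ ∷ u₂ ∷ v₁ ∷ v₂ ∷ a ∷ b ∷ b′ ∷ c ∷ [])

recurrence-3n-2 : ∀ a b b′ c {x} →
  x ≡ + 9 *ℤ a +ℤ + 0 *ℤ b +ℤ + 0 *ℤ b′ +ℤ + 0 *ℤ c →
  x ≡ + 9 *ℤ a
recurrence-3n-2 a b b′ c refl = ℤ-Ring.solve (a ∷ b ∷ b′ ∷ c ∷ [])

recurrence-9n-7 : ∀ a b b′ c {y x₂₂ x₃₃ x₄₄} →
  y   ≡ + 64 *ℤ a +ℤ + 8 *ℤ b +ℤ + 8 *ℤ b′ +ℤ + 1 *ℤ c →
  x₂₂ ≡ + 4 *ℤ a +ℤ + 2 *ℤ b +ℤ + 2 *ℤ b′ +ℤ + 1 *ℤ c →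
  x₃₃ ≡ + 1 *ℤ a +ℤ + 2 *ℤ b +ℤ + 2 *ℤ b′ +ℤ + 4 *ℤ c →
  x₄₄ ≡ + 0 *ℤ a +ℤ + 0 *ℤ b +ℤ + 0 *ℤ b′ +ℤ + 9 *ℤ c →
  y ≡ (+ 5 *ℤ x₄₄ - + 16 *ℤ x₃₃) +ℤ + 20 *ℤ x₂₂
recurrence-9n-7 a b b′ c refl refl refl refl = ℤ-Ring.solve (a ∷ b ∷ b′ ∷ c ∷ [])

recurrence-9n-4 : ∀ a b b′ c {y x₂₂ x₃₃ x₄₄} →
  y   ≡ + 25 *ℤ a +ℤ + 20 *ℤ b +ℤ + 20 *ℤ b′ +ℤ + 16 *ℤ c →
  x₂₂ ≡ + 4 *ℤ a +ℤ + 2 *ℤ b +ℤ + 2 *ℤ b′ +ℤ + 1 *ℤ c →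
  x₃₃ ≡ + 1 *ℤ a +ℤ + 2 *ℤ b +ℤ + 2 *ℤ b′ +ℤ + 4 *ℤ c →
  x₄₄ ≡ + 0 *ℤ a +ℤ + 0 *ℤ b +ℤ + 0 *ℤ b′ +ℤ + 9 *ℤ c →
  y ≡ ((+ 0 - x₄₄) +ℤ + 5 *ℤ x₃₃) +ℤ + 5 *ℤ x₂₂
recurrence-9n-4 a b b′ c refl refl refl refl = ℤ-Ring.solve (a ∷ b ∷ b′ ∷ c ∷ [])

recurrence-9n-1 : ∀ a b b′ c {y x₂₂ x₃₃ x₄₄} →
  y   ≡ + 4 *ℤ a +ℤ + 14 *ℤ b +ℤ + 14 *ℤ b′ +ℤ + 49 *ℤ c →
  x₂₂ ≡ + 4 *ℤ a +ℤ + 2 *ℤ b +ℤ + 2 *ℤ b′ +ℤ + 1 *ℤ c →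
  x₃₃ ≡ + 1 *ℤ a +ℤ + 2 *ℤ b +ℤ + 2 *ℤ b′ +ℤ + 4 *ℤ c →
  x₄₄ ≡ + 0 *ℤ a +ℤ + 0 *ℤ b +ℤ + 0 *ℤ b′ +ℤ + 9 *ℤ c →
  y ≡ (+ 2 *ℤ x₄₄ +ℤ + 8 *ℤ x₃₃) - x₂₂
recurrence-9n-1 a b b′ c refl refl refl refl = ℤ-Ring.solve (a ∷ b ∷ b′ ∷ c ∷ [])

recurrence-3n : ∀ a b b′ c {x₂₂ x₃₃} →
  x₂₂ ≡ + 4 *ℤ a +ℤ + 2 *ℤ b +ℤ + 2 *ℤ b′ +ℤ + 1 *ℤ c →
  x₃₃ ≡ + 1 *ℤ a +ℤ + 2 *ℤ b +ℤ + 2 *ℤ b′ +ℤ + 4 *ℤ c →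
  x₃₃ ≡ (x₂₂ +ℤ + 3 *ℤ c) - + 3 *ℤ a
recurrence-3n a b b′ c refl refl = ℤ-Ring.solve (a ∷ b ∷ b′ ∷ c ∷ [])

3[1+p]≡3+p*3 : ∀ p → 3 * suc p ≡ 3 + p * 3
3[1+p]≡3+p*3 = ℕ-Ring.solve-∀

3[1+p]+1≡4+p*3 : ∀ p → 3 * suc p + 1 ≡ 4 + p * 3
3[1+p]+1≡4+p*3 = ℕ-Ring.solve-∀

9[1+p]≡9+p*3*3 : ∀ p → 9 * suc p ≡ 9 + p * 3 * 3
9[1+p]≡9+p*3*3 = ℕ-Ring.solve-∀

squareCount : ℕ → ℕ
squareCount n = count n n

reindex : ∀ {k l z} → k ≡ l → + squareCount l ≡ z → + squareCount k ≡ z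
reindex refl eq = eq

recurrences : ∀ n → 2 ≤ n →
    (+ squareCount (3 * n ∸ 2) ≡ + 9 *ℤ + squareCount n)
  × (+ squareCount (9 * n ∸ 7) ≡ (+ 5 *ℤ + squareCount (3 * n + 1) - + 16 *ℤ + squareCount (3 * n)) +ℤ + 20 *ℤ + squareCount (3 * n ∸ 1))
  × (+ squareCount (9 * n ∸ 4) ≡ ((+ 0 - + squareCount (3 * n + 1)) +ℤ + 5 *ℤ + squareCount (3 * n)) +ℤ + 5 *ℤ + squareCount (3 * n ∸ 1))
  × (+ squareCount (9 * n ∸ 1) ≡ (+ 2 *ℤ + squareCount (3 * n + 1) +ℤ + 8 *ℤ + squareCount (3 * n)) - + squareCount (3 * n ∸ 1))
  × (+ squareCount (3 * n) ≡ (+ squareCount (3 * n ∸ 1) +ℤ + 3 *ℤ + squareCount (n + 1)) - + 3 *ℤ + squareCount n)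
recurrences (suc p) (s≤s 1≤p) =
    recurrence-3n-2 a b b′ c A[3n-2]
  , recurrence-9n-7 a b b′ c A[9n-7] A[3n-1] A[3n] A[3n+1]
  , recurrence-9n-4 a b b′ c A[9n-4] A[3n-1] A[3n] A[3n+1]
  , recurrence-9n-1 a b b′ c A[9n-1] A[3n-1] A[3n] A[3n+1]
  , subst (λ k → + squareCount (3 * suc p) ≡ (+ squareCount (3 * suc p ∸ 1) +ℤ + 3 *ℤ + squareCount k) - + 3 *ℤ a)
          (+-comm 1 (suc p)) (recurrence-3n a b b′ c A[3n-1] A[3n])
  where
  a b b′ c : ℤ
  a = + count (1 + p) (1 + p)
  b = + count (1 + p) (2 + p)
  b′ = + count (2 + p) (1 + p)
  c = + count (2 + p) (2 + p)
  A[3n-2] : + squareCount (3 * suc p ∸ 2) ≡ + 9 *ℤ a +ℤ + 0 *ℤ b +ℤ + 0 *ℤ b′ +ℤ + 0 *ℤ c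
  A[3n-2] = reindex (cong (_∸ 2) (3[1+p]≡3+p*3 p)) (count-weightsℤ 1 1 1≤p 1≤p)
  A[3n-1] : + squareCount (3 * suc p ∸ 1) ≡ + 4 *ℤ a +ℤ + 2 *ℤ b +ℤ + 2 *ℤ b′ +ℤ + 1 *ℤ c
  A[3n-1] = reindex (cong (_∸ 1) (3[1+p]≡3+p*3 p)) (count-weightsℤ 2 2 1≤p 1≤p)
  A[3n] : + squareCount (3 * suc p) ≡ + 1 *ℤ a +ℤ + 2 *ℤ b +ℤ + 2 *ℤ b′ +ℤ + 4 *ℤ c
  A[3n] = reindex (3[1+p]≡3+p*3 p) (count-weightsℤ 3 3 1≤p 1≤p)
  A[3n+1] : + squareCount (3 * suc p + 1) ≡ + 0 *ℤ a +ℤ + 0 *ℤ b +ℤ + 0 *ℤ b′ +ℤ + 9 *ℤ c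
  A[3n+1] = reindex (3[1+p]+1≡4+p*3 p) (count-weightsℤ 4 4 1≤p 1≤p)
  1≤p*3 : 1 ≤ p * 3
  1≤p*3 = ≤-trans 1≤p (m≤m*n p 3)
  A[9n-7] : + squareCount (9 * suc p ∸ 7) ≡ + 64 *ℤ a +ℤ + 8 *ℤ b +ℤ + 8 *ℤ b′ +ℤ + 1 *ℤ c
  A[9n-7] = reindex (cong (_∸ 7) (9[1+p]≡9+p*3*3 p))
    (compose (+ 3) (+ 0) (+ 2) (+ 1) a b b′ c (count-weightsℤ 2 2 1≤p*3 1≤p*3)
      (count-weightsℤ 1 1 1≤p 1≤p) (count-weightsℤ 1 2 1≤p 1≤p) (count-weightsℤ 2 1 1≤p 1≤p) (count-weightsℤ 2 2 1≤p 1≤p))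
  A[9n-4] : + squareCount (9 * suc p ∸ 4) ≡ + 25 *ℤ a +ℤ + 20 *ℤ b +ℤ + 20 *ℤ b′ +ℤ + 16 *ℤ c
  A[9n-4] = reindex (cong (_∸ 4) (9[1+p]≡9+p*3*3 p))
    (compose (+ 2) (+ 1) (+ 1) (+ 2) a b b′ c (count-weightsℤ 2 2 {1 + p * 3} {1 + p * 3} (s≤s z≤n) (s≤s z≤n))
      (count-weightsℤ 2 2 1≤p 1≤p) (count-weightsℤ 2 3 1≤p 1≤p) (count-weightsℤ 3 2 1≤p 1≤p) (count-weightsℤ 3 3 1≤p 1≤p))
  A[9n-1] : + squareCount (9 * suc p ∸ 1) ≡ + 4 *ℤ a +ℤ + 14 *ℤ b +ℤ + 14 *ℤ b′ +ℤ + 49 *ℤ c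
  A[9n-1] = reindex (cong (_∸ 1) (9[1+p]≡9+p*3*3 p))
    (compose (+ 1) (+ 2) (+ 0) (+ 3) a b b′ c (count-weightsℤ 2 2 {2 + p * 3} {2 + p * 3} (s≤s z≤n) (s≤s z≤n))
      (count-weightsℤ 3 3 1≤p 1≤p) (count-weightsℤ 3 4 1≤p 1≤p) (count-weightsℤ 4 3 1≤p 1≤p) (count-weightsℤ 4 4 1≤p 1≤p))

has-count : ∀ n → 1 ≤ n → HasCount n (squareCount n)
has-count n 1≤n =
  patterns n n n , refl , patterns-unique n near ≤-refl , patterns-occur n near ≤-refl ,
  λ { _ (k , a , b , a-bound , b-bound , refl) → patterns-complete k n near ≤-refl a-bound b-bound }
  where
  near : NearSquare n n
  near = 1≤n , 1≤n , n≤1+n n , n≤1+n n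

lemma6 : ∃ λ (A : ℕ → ℕ) →
      (∀ n → 1 ≤ n → HasCount n (A n))
    × (∀ n → 2 ≤ n →
          (+ A (3 * n ∸ 2) ≡ + 9 *ℤ + A n)
        × (+ A (9 * n ∸ 7) ≡ (+ 5 *ℤ + A (3 * n + 1) - + 16 *ℤ + A (3 * n)) +ℤ + 20 *ℤ + A (3 * n ∸ 1))
        × (+ A (9 * n ∸ 4) ≡ ((+ 0 - + A (3 * n + 1)) +ℤ + 5 *ℤ + A (3 * n)) +ℤ + 5 *ℤ + A (3 * n ∸ 1))
        × (+ A (9 * n ∸ 1) ≡ (+ 2 *ℤ + A (3 * n + 1) +ℤ + 8 *ℤ + A (3 * n)) - + A (3 * n ∸ 1))
        × (+ A (3 * n) ≡ (+ A (3 * n ∸ 1) +ℤ + 3 *ℤ + A (n + 1)) - + 3 *ℤ + A n))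
    × (A 1 ≡ 2) × (A 2 ≡ 14) × (A 3 ≡ 70) × (A 4 ≡ 126)
    × (A 5 ≡ 270) × (A 6 ≡ 438) × (A 7 ≡ 630) × (A 8 ≡ 790)
lemma6 = squareCount , has-count , recurrences , refl , refl , refl , refl , refl , refl , refl , refl
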